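{- For every finite non-empty set $\Lambda$ and every finite non-empty set $\mathsf{C}$, $$\mathrm{HJ}_{\mathsf{C}}(1,\Lambda)\;\le\; \mathtt{f}^{8,\ast}_{\Lambda}\Big(|\Lambda|^2\cdot \mathrm{W}_{\mathsf{C}}(|\Lambda|,1),\ \mathsf{C}\Big).$$
   Context: For a natural number $n$ identify $n=\{0,\dots,n-1\}$. For a finite non-empty linear order $M$ and a finite non-empty set $\Lambda$ (alphabet), $\mathcal{U}_{M,\Lambda}$ is the set of all functions $\eta:M\to\Lambda$. For pairwise disjoint non-empty subsets $M_\ell$ ($\ell<m$) of $M$ and a map $\rho:M\setminus\bigcup_{\ell<m}M_\ell\to\Lambda$, the $m$-dimensional subspace $\mathcal{S}(\langle M_\ell:\ell<m\rangle,\rho)$ is the set of $\nu\in\mathcal{U}_{M,\Lambda}$ with $\nu\restriction (M\setminus\bigcup_\ell M_\ell)=\rho$ and $\nu\restriction M_\ell$ constant for each $\ell<m$; a line is a $1$-dimensional subspace. $\mathsf{C}$ is a finite non-empty set of colors. The Hales–Jewett number $\mathrm{HJ}_{\mathsf{C}}(m,\Lambda)$ is the least $k$ such that for every linear order $M$ of size $k$ and every coloring $\mathbf{d}:\mathcal{U}_{M,\Lambda}\to\mathsf{C}$ there is a $\mathbf{d}$-monochromatic $m$-dimensional subspace of $\mathcal{U}_{M,\Lambda}$. The Gallai–Witt number $\mathrm{W}_{\mathsf{C}}(h,m)$ is the least $n$ such that for every coloring $\mathbf{d}:\mathcal{U}_{h,n}\to\mathsf{C}$ (functions from $\{0,\dots,h-1\}$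 to $\{0,\dots,n-1\}$) there are $d>0$ and natural numbers $\langle m_e:e<h\rangle$ with $m_e+d\cdot m<n$ for each $e<h$ such that $\mathbf{d}$ is constant on $\{\langle m_e+d\cdot i_e: e<h\rangle : i_0,\dots,i_{h-1}\le m\}$. For $m$ divisible by $|\Lambda|$, $\mathtt{f}^{8,\ast}_{\Lambda}(m,\mathsf{C})$ is the least $k$ divisible by $|\Lambda|$ such that for every linear order $M$ of size $k$ and every coloring $\mathbf{d}:\mathcal{U}_{M,\Lambda}\to\mathsf{C}$ there are pairwise disjoint non-empty subsets $M_\ell$ ($\ell<m$) of $M$ and a map $\rho:M\setminus\bigcup_{\ell<m}M_\ell\to\Lambda$ such that for all $\nu_1,\nu_2\in\mathcal{S}(\langle M_\ell:\ell<m\rangle,\rho)$, $\mathbf{d}(\nu_1)=\mathbf{d}(\nu_2)$ whenever for every $\alpha\in\Lambda$, $|\{\ell<m:\nu_1\restriction M_\ell\equiv\alpha\}|=|\{\ell<m:\nu_2\restriction M_\ell\equiv\alpha\}|$. -}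

module Defs where

open import Data.Nat using (ℕ; zero; suc; _+_; _*_; _≤_; _<_)
open import Data.Nat.Divisibility using (_∣_)
open import Data.Fin using (Fin; toℕ)
open import Data.Fin.Properties using (all?; _≟_)
open import Data.Fin.Subset using (Subset; _∈_; _∉_; Nonempty)
open import Data.Fin.Subset.Properties using (_∈?_)
open import Data.List using (List; length; filter)
open import Data.List.Base using (allFin)
open import Data.Product using (Σ; _×_; ∃)
open import Relation.Nullary using (¬_; Dec)
open import Relation.Nullary.Decidable using (_→-dec_)
open import Relation.Binary.PropositionalEquality using (_≡_; _≢_)

-- Words: 𝒰_{M,Λ} with M = Fin k (size k) and Λ = Fin L.
Word : ℕ → ℕ → Set
Word k L = Fin k → Fin L

-- Data of an m-dimensional subspace S(⟨M_ℓ : ℓ < m⟩, ρ) of 𝒰_{Fin k, Fin L}.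
-- ρ is given as a total map Fin k → Fin L; only its values off ⋃ M_ℓ matter.
record Subspace (k m L : ℕ) : Set where
  field
    blocks   : Fin m → Subset k
    nonempty : ∀ ℓ → Nonempty (blocks ℓ)
    disjoint : ∀ ℓ ℓ' → ℓ ≢ ℓ' → ∀ i → i ∈ blocks ℓ → i ∉ blocks ℓ'
    ρ        : Fin k → Fin L

open Subspace public

_∈S_ : ∀ {k m L} → Word k L → Subspace k m L → Set
_∈S_ {k} {m} ν S =
  (∀ i → (∀ ℓ → i ∉ blocks S ℓ) → ν i ≡ ρ S i) ×
  (∀ ℓ i j → i ∈ blocks S ℓ → j ∈ blocks S ℓ → ν i ≡ ν j)

ConstOn : ∀ {k L} → Word k L → Subset k → Fin L → Set
ConstOn ν P α = ∀ i → i ∈ P → ν i ≡ α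

constOn? : ∀ {k L} (ν : Word k L) (P : Subset k) (α : Fin L) → Dec (ConstOn ν P α)
constOn? ν P α = all? (λ i → (i ∈? P) →-dec (ν i ≟ α))

count : ∀ {k m L} → Subspace k m L → Word k L → Fin L → ℕ
count {m = m} S ν α = length (filter (λ ℓ → constOn? ν (blocks S ℓ) α) (allFin m))

IsLeast : (ℕ → Set) → ℕ → Set
IsLeast P n = P n × (∀ k → P k → n ≤ k)

HJProp : (C m L k : ℕ) → Set
HJProp C m L k =
  (d : Word k L → Fin C) →
  Σ (Subspace k m L) λ S → ∀ ν₁ ν₂ → ν₁ ∈S S → ν₂ ∈S S → d ν₁ ≡ d ν₂

-- HJ_C(m, Λ) = n  (with |C| = C, |Λ| = L)
IsHJ : (C m L n : ℕ) → Set
IsHJ C m L = IsLeast (HJProp C m L)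

WProp : (C h m n : ℕ) → Set
WProp C h m n =
  (d : (Fin h → Fin n) → Fin C) →
  Σ ℕ λ δ → (0 < δ) × Σ (Fin h → ℕ) λ base →
    (∀ e → base e + δ * m < n) ×
    (∀ x y →
      (∃ λ (i : Fin h → ℕ) → (∀ e → i e ≤ m) × (∀ e → toℕ (x e) ≡ base e + δ * i e)) →
      (∃ λ (j : Fin h → ℕ) → (∀ e → j e ≤ m) × (∀ e → toℕ (y e) ≡ base e + δ * j e)) →
      d x ≡ d y)

IsW : (C h m n : ℕ) → Set
IsW C h m = IsLeast (WProp C h m)

F8Prop : (C L m k : ℕ) → Set
F8Prop C L m k =
  (L ∣ k) ×
  ((d : Word k L → Fin C) →
   Σ (Subspace k m L) λ S → ∀ ν₁ ν₂ → ν₁ ∈S S → ν₂ ∈S S →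
     (∀ α → count S ν₁ α ≡ count S ν₂ α) → d ν₁ ≡ d ν₂)

-- f^{8,*}_Λ(m, C) = k   (meaningful for |Λ| ∣ m)
IsF8 : (C L m k : ℕ) → Set
IsF8 C L m = IsLeast (F8Prop C L m)

-- Encode a point x of the grid [w]^Λ as the word of the count-invariant subspace in
-- which the blocks are arranged in rows of length w and the first x β blocks of row β
-- carry the letter β, all other blocks the letter 0.  Gallai–Witt yields base and δ
-- such that the corners base + δ eα all get the same colour.  Glue δ blocks of row 0,
-- which carry 0 in the word of base, into a single block: the point of this line with
-- letter α has the letter counts of the word of base + δ eα, since both arise from the
-- word of base by turning δ of its letters 0 into α.  By count invariance the line is
-- monochromatic.

module Submission where

open import Defs
open import Data.Nat using (ℕ; zero; suc; _+_; _*_; _≤_; _<_; _≤?_; _<?_; z≤n; s≤s; s≤s⁻¹; s<s⁻¹)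
open import Data.Nat.Properties
open import Data.Fin using (Fin; toℕ; fromℕ<) renaming (zero to fzero; suc to fsuc)
open import Data.Fin.Properties using (toℕ-injective; toℕ<n; toℕ-fromℕ<; any?) renaming (_≟_ to _≟ᶠ_)
open import Data.Fin.Subset using (Subset; _∈_; _∉_)
open import Data.Fin.Subset.Properties using (_∈?_)
open import Data.List using (List; []; _∷_; length; filter; map)
open import Data.List.Base using (allFin; tabulate)
open import Data.List.Properties using (filter-≐; map-tabulate)
open import Data.Vec using () renaming (tabulate to tabulateᵛ)
open import Data.Vec.Properties using (lookup∘tabulate; lookup⇒[]=; []=⇒lookup)
open import Data.Bool using (true; false; if_then_else_)
open import Data.Product using (Σ; _×_; _,_; proj₁; proj₂; ∃)
open import Function using (id; _∘_)
open import Relation.Nullary using (¬_; Dec; yes; no; does; ¬?; contradiction)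
open import Relation.Nullary.Decidable using (_×-dec_; dec-true; dec-false)
open import Relation.Unary using (Decidable; _≐_)
open import Relation.Binary using (DecidableEquality)
open import Relation.Binary.PropositionalEquality

countBy : {A : Set} {P : A → Set} → Decidable P → List A → ℕ
countBy P? xs = length (filter P? xs)

module _ {A : Set} {P Q : A → Set} (P? : Decidable P) (Q? : Decidable Q) where

  countBy-≐ : P ≐ Q → ∀ xs → countBy P? xs ≡ countBy Q? xs
  countBy-≐ P≐Q xs = cong length (filter-≐ P? Q? P≐Q xs)

  countBy-split : ∀ xs → countBy Q? xs ≡
    countBy (λ x → P? x ×-dec Q? x) xs + countBy (λ x → ¬? (P? x) ×-dec Q? x) xs
  countBy-split [] = refl
  countBy-split (x ∷ xs) with P? x | Q? x
  ... | yes _ | yes _ = cong suc (countBy-split xs)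
  ... | yes _ | no _  = countBy-split xs
  ... | no _  | yes _ = trans (cong suc (countBy-split xs)) (sym (+-suc _ _))
  ... | no _  | no _  = countBy-split xs

countBy-none : {A : Set} {P : A → Set} (P? : Decidable P) → (∀ x → ¬ P x) → ∀ xs → countBy P? xs ≡ 0
countBy-none P? ¬P [] = refl
countBy-none P? ¬P (x ∷ xs) with P? x
... | yes p = contradiction p (¬P x)
... | no _  = countBy-none P? ¬P xs

countBy-map : {A B : Set} {P : B → Set} (P? : Decidable P) (f : A → B) →
  ∀ xs → countBy P? (map f xs) ≡ countBy (P? ∘ f) xs
countBy-map P? f [] = refl
countBy-map P? f (x ∷ xs) with P? (f x)
... | yes _ = cong suc (countBy-map P? f xs)
... | no _  = countBy-map P? f xs

countBy-×-const : {A B D : Set} {P : A → Set} {Q : B → Set} (P? : Decidable P) (Q? : Decidable Q) →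
  ∀ xs ys → countBy P? xs ≡ countBy Q? ys → (D? : Dec D) →
  countBy (λ x → P? x ×-dec D?) xs ≡ countBy (λ y → Q? y ×-dec D?) ys
countBy-×-const P? Q? xs ys eq (yes d) = begin
  countBy (λ x → P? x ×-dec yes d) xs  ≡⟨ countBy-≐ _ P? (proj₁ , (_, d)) xs ⟩
  countBy P? xs                        ≡⟨ eq ⟩
  countBy Q? ys                        ≡⟨ countBy-≐ Q? _ ((_, d) , proj₁) ys ⟩
  countBy (λ y → Q? y ×-dec yes d) ys  ∎
  where open ≡-Reasoning
countBy-×-const P? Q? xs ys eq (no ¬d) =
  trans (countBy-none _ (λ _ → ¬d ∘ proj₂) xs) (sym (countBy-none _ (λ _ → ¬d ∘ proj₂) ys))

record Overwrite {A B : Set} (P : A → Set) (f : A → B) (α : B) (g : A → B) : Set where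
  field
    inside  : ∀ x → P x → g x ≡ α
    outside : ∀ x → ¬ P x → g x ≡ f x

module _ {A B : Set} (_≟_ : DecidableEquality B) where

  countBy-overwrite : {P : A → Set} (P? : Decidable P) {f g : A → B} {z α : B} →
    (∀ x → P x → f x ≡ z) → Overwrite P f α g → ∀ γ xs →
    countBy (λ x → g x ≟ γ) xs + countBy (λ x → P? x ×-dec z ≟ γ) xs
      ≡ countBy (λ x → f x ≟ γ) xs + countBy (λ x → P? x ×-dec α ≟ γ) xs
  countBy-overwrite {P} P? {f} {g} {z} {α} f≡z g≔α γ xs = begin
    all-of g + onP z                     ≡⟨ cong (_+ onP z) (countBy-split P? (λ x → g x ≟ γ) xs) ⟩
    onP-of g + offP-of g + onP z         ≡⟨ cong (λ c → c + offP-of g + onP z) (countBy-≐ _ _ g-on xs) ⟩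
    onP α + offP-of g + onP z            ≡⟨ cong (λ c → onP α + c + onP z) (countBy-≐ _ _ g-off xs) ⟩
    onP α + offP-of f + onP z            ≡⟨ shuffle (onP α) (offP-of f) (onP z) ⟩
    onP z + offP-of f + onP α            ≡⟨ cong (λ c → c + offP-of f + onP α) (countBy-≐ _ _ f-on xs) ⟨
    onP-of f + offP-of f + onP α         ≡⟨ cong (_+ onP α) (countBy-split P? (λ x → f x ≟ γ) xs) ⟨
    all-of f + onP α                     ∎
    where
    open ≡-Reasoning
    open Overwrite g≔α
    all-of : (A → B) → ℕ
    all-of h = countBy (λ x → h x ≟ γ) xs
    onP : B → ℕ
    onP c = countBy (λ x → P? x ×-dec c ≟ γ) xs
    onP-of offP-of : (A → B) → ℕ
    onP-of h = countBy (λ x → P? x ×-dec h x ≟ γ) xs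
    offP-of h = countBy (λ x → ¬? (P? x) ×-dec h x ≟ γ) xs
    g-on : (λ x → P x × g x ≡ γ) ≐ (λ x → P x × α ≡ γ)
    g-on = (λ (p , e) → p , trans (sym (inside _ p)) e) , (λ (p , e) → p , trans (inside _ p) e)
    g-off : (λ x → ¬ P x × g x ≡ γ) ≐ (λ x → ¬ P x × f x ≡ γ)
    g-off = (λ (p , e) → p , trans (sym (outside _ p)) e) , (λ (p , e) → p , trans (outside _ p) e)
    f-on : (λ x → P x × f x ≡ γ) ≐ (λ x → P x × z ≡ γ)
    f-on = (λ (p , e) → p , trans (sym (f≡z _ p)) e) , (λ (p , e) → p , trans (f≡z _ p) e)
    shuffle : ∀ a b c → a + b + c ≡ c + b + a
    shuffle a b c = trans (+-comm (a + b) c) (trans (cong (c +_) (+-comm a b)) (sym (+-assoc c b a)))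

  countBy-overwrites : {P Q : A → Set} (P? : Decidable P) (Q? : Decidable Q) {f g h : A → B} {z α : B} →
    ∀ xs → countBy P? xs ≡ countBy Q? xs →
    (∀ x → P x → f x ≡ z) → (∀ x → Q x → f x ≡ z) →
    Overwrite P f α g → Overwrite Q f α h →
    ∀ γ → countBy (λ x → g x ≟ γ) xs ≡ countBy (λ x → h x ≟ γ) xs
  countBy-overwrites P? Q? {f} {g} {h} {z} {α} xs |P|≡|Q| f≡z-on-P f≡z-on-Q g≔α h≔α γ =
    +-cancelʳ-≡ (countBy (λ x → P? x ×-dec z ≟ γ) xs) _ _ (begin
      countBy (λ x → g x ≟ γ) xs + countBy (λ x → P? x ×-dec z ≟ γ) xs
        ≡⟨ countBy-overwrite P? f≡z-on-P g≔α γ xs ⟩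
      countBy (λ x → f x ≟ γ) xs + countBy (λ x → P? x ×-dec α ≟ γ) xs
        ≡⟨ cong (countBy (λ x → f x ≟ γ) xs +_) (countBy-×-const P? Q? xs xs |P|≡|Q| (α ≟ γ)) ⟩
      countBy (λ x → f x ≟ γ) xs + countBy (λ x → Q? x ×-dec α ≟ γ) xs
        ≡⟨ countBy-overwrite Q? f≡z-on-Q h≔α γ xs ⟨
      countBy (λ x → h x ≟ γ) xs + countBy (λ x → Q? x ×-dec z ≟ γ) xs
        ≡⟨ cong (countBy (λ x → h x ≟ γ) xs +_) (countBy-×-const P? Q? xs xs |P|≡|Q| (z ≟ γ)) ⟨
      countBy (λ x → h x ≟ γ) xs + countBy (λ x → P? x ×-dec z ≟ γ) xs ∎)
    where open ≡-Reasoning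

InWindow : ℕ → ℕ → ℕ → Set
InWindow p δ n = p ≤ n × n < p + δ

inWindow? : ∀ p δ → Decidable (InWindow p δ)
inWindow? p δ n = p ≤? n ×-dec n <? p + δ

window-widen : ∀ {p q r n} → q ≤ r → InWindow p q n → InWindow p r n
window-widen q≤r (p≤n , n<p+q) = p≤n , <-≤-trans n<p+q (+-monoʳ-≤ _ q≤r)

window-cut : ∀ {p q δ n} → InWindow p (q + δ) n → ¬ InWindow (p + q) δ n → InWindow p q n
window-cut {p} {q} {δ} {n} (p≤n , n<p+q+δ) n∉ with n <? p + q
... | yes n<p+q = p≤n , n<p+q
... | no n≮p+q = contradiction (≮⇒≥ n≮p+q , subst (n <_) (sym (+-assoc p q δ)) n<p+q+δ) n∉

countBy-tabulate-suc : ∀ {m} {P : ℕ → Set} (P? : Decidable P) →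
  countBy (P? ∘ toℕ) (tabulate {n = m} fsuc) ≡ countBy (P? ∘ suc ∘ toℕ) (allFin m)
countBy-tabulate-suc {m} P? =
  trans (cong (countBy (P? ∘ toℕ)) (sym (map-tabulate {n = m} id fsuc))) (countBy-map (P? ∘ toℕ) fsuc (allFin m))

countBy-window : ∀ {m} p δ → p + δ ≤ m → countBy (inWindow? p δ ∘ toℕ) (allFin m) ≡ δ
countBy-window {m} p zero _ =
  countBy-none _ (λ ℓ (p≤ℓ , ℓ<p+0) → n≮n p (≤-<-trans p≤ℓ (subst (toℕ ℓ <_) (+-identityʳ p) ℓ<p+0))) (allFin m)
countBy-window {suc m} zero (suc δ) (s≤s δ≤m) = cong suc (begin
  countBy (inWindow? 0 (suc δ) ∘ toℕ) (tabulate {n = m} fsuc)  ≡⟨ countBy-tabulate-suc {m} (inWindow? 0 (suc δ)) ⟩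
  countBy (inWindow? 0 (suc δ) ∘ suc ∘ toℕ) (allFin m)         ≡⟨ countBy-≐ _ _ shift (allFin m) ⟩
  countBy (inWindow? 0 δ ∘ toℕ) (allFin m)                     ≡⟨ countBy-window zero δ δ≤m ⟩
  δ                                                            ∎)
  where
  open ≡-Reasoning
  shift : (λ ℓ → InWindow 0 (suc δ) (suc (toℕ ℓ))) ≐ (λ ℓ → InWindow 0 δ (toℕ ℓ))
  shift = (λ (_ , ℓ<) → z≤n , s<s⁻¹ ℓ<) , (λ (_ , ℓ<) → z≤n , s≤s ℓ<)
countBy-window {suc m} (suc p) δ (s≤s p+δ≤m) = begin
  countBy (inWindow? (suc p) δ ∘ toℕ) (tabulate {n = m} fsuc)  ≡⟨ countBy-tabulate-suc {m} (inWindow? (suc p) δ) ⟩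
  countBy (inWindow? (suc p) δ ∘ suc ∘ toℕ) (allFin m)         ≡⟨ countBy-≐ _ _ shift (allFin m) ⟩
  countBy (inWindow? p δ ∘ toℕ) (allFin m)                     ≡⟨ countBy-window p δ p+δ≤m ⟩
  δ                                                            ∎
  where
  open ≡-Reasoning
  shift : (λ ℓ → InWindow (suc p) δ (suc (toℕ ℓ))) ≐ (λ ℓ → InWindow p δ (toℕ ℓ))
  shift = (λ (p≤ , ℓ<) → s≤s⁻¹ p≤ , s<s⁻¹ ℓ<) , (λ (p≤ , ℓ<) → s≤s p≤ , s≤s ℓ<)

decSubset : ∀ {k} {P : Fin k → Set} → Decidable P → Subset k
decSubset P? = tabulateᵛ (λ i → does (P? i))

module _ {k} {P : Fin k → Set} (P? : Decidable P) where

  ∈-decSubset⁺ : ∀ {i} → P i → i ∈ decSubset P?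
  ∈-decSubset⁺ {i} p = lookup⇒[]= i _ (trans (lookup∘tabulate _ i) (dec-true (P? i) p))

  ∈-decSubset⁻ : ∀ {i} → i ∈ decSubset P? → P i
  ∈-decSubset⁻ {i} i∈ with P? i | trans (sym (lookup∘tabulate (λ j → does (P? j)) i)) ([]=⇒lookup i∈)
  ... | yes p | _ = p
  ... | no _ | ()

module _ {k m L : ℕ} (S : Subspace k m L) where

  blocks-unique : ∀ {i ℓ ℓ'} → i ∈ blocks S ℓ → i ∈ blocks S ℓ' → ℓ ≡ ℓ'
  blocks-unique {i} {ℓ} {ℓ'} i∈ℓ i∈ℓ' with ℓ ≟ᶠ ℓ'
  ... | yes ℓ≡ℓ' = ℓ≡ℓ'
  ... | no ℓ≢ℓ' = contradiction i∈ℓ' (disjoint S ℓ ℓ' ℓ≢ℓ' i i∈ℓ)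

  fill : (Fin m → Fin L) → Word k L
  fill A i with any? (λ ℓ → i ∈? blocks S ℓ)
  ... | yes (ℓ , _) = A ℓ
  ... | no _ = ρ S i

  fill-block : ∀ A {i ℓ} → i ∈ blocks S ℓ → fill A i ≡ A ℓ
  fill-block A {i} {ℓ} i∈ℓ with any? (λ ℓ → i ∈? blocks S ℓ)
  ... | yes (ℓ' , i∈ℓ') = cong A (blocks-unique i∈ℓ' i∈ℓ)
  ... | no i∉ = contradiction (ℓ , i∈ℓ) i∉

  fill-outside : ∀ A {i} → (∀ ℓ → i ∉ blocks S ℓ) → fill A i ≡ ρ S i
  fill-outside A {i} i∉ with any? (λ ℓ → i ∈? blocks S ℓ)
  ... | yes (ℓ , i∈ℓ) = contradiction i∈ℓ (i∉ ℓ)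
  ... | no _ = refl

  fill-∈S : ∀ A → fill A ∈S S
  fill-∈S A = (λ i i∉ → fill-outside A i∉) , (λ ℓ i j i∈ j∈ → trans (fill-block A i∈) (sym (fill-block A j∈)))

  point : Fin m → Fin k
  point ℓ = proj₁ (nonempty S ℓ)

  point∈ : ∀ ℓ → point ℓ ∈ blocks S ℓ
  point∈ ℓ = proj₂ (nonempty S ℓ)

  letter : Word k L → Fin m → Fin L
  letter ν ℓ = ν (point ℓ)

  letter-fill : ∀ A ℓ → letter (fill A) ℓ ≡ A ℓ
  letter-fill A ℓ = fill-block A (point∈ ℓ)

  count-letter : ∀ {ν} → ν ∈S S → ∀ γ → count S ν γ ≡ countBy (λ ℓ → letter ν ℓ ≟ᶠ γ) (allFin m)
  count-letter {ν} (_ , ν-const) γ = countBy-≐ _ _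
    ((λ ν≡γ → ν≡γ (point _) (point∈ _)) , (λ {ℓ} ν≡γ i i∈ → trans (ν-const ℓ i (point ℓ) i∈ (point∈ ℓ)) ν≡γ))
    (allFin m)

-- Gluing a decidable family of blocks of a subspace into a single line

module _ {k m L : ℕ} (S : Subspace k m L) {P : Fin m → Set} (P? : Decidable P)
         (ℓ₀ : Fin m) (Pℓ₀ : P ℓ₀) (A : Fin m → Fin L) where

  inGlued? : Decidable (λ i → ∃ λ ℓ → i ∈ blocks S ℓ × P ℓ)
  inGlued? i = any? (λ ℓ → i ∈? blocks S ℓ ×-dec P? ℓ)

  glued : Subset k
  glued = decSubset inGlued?

  ∈-glued : ∀ {i ℓ} → i ∈ blocks S ℓ → P ℓ → i ∈ glued
  ∈-glued i∈ℓ Pℓ = ∈-decSubset⁺ inGlued? (_ , i∈ℓ , Pℓ)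

  ∉-glued : ∀ {i ℓ} → i ∈ blocks S ℓ → ¬ P ℓ → i ∉ glued
  ∉-glued i∈ℓ ¬Pℓ i∈glued with ∈-decSubset⁻ inGlued? i∈glued
  ... | _ , i∈ℓ' , Pℓ' = ¬Pℓ (subst P (blocks-unique S i∈ℓ' i∈ℓ) Pℓ')

  ∉-glued-outside : ∀ {i} → (∀ ℓ → i ∉ blocks S ℓ) → i ∉ glued
  ∉-glued-outside i∉ i∈glued with ∈-decSubset⁻ inGlued? i∈glued
  ... | ℓ , i∈ℓ , _ = i∉ ℓ i∈ℓ

  gluedLine : Subspace k 1 L
  gluedLine = record
    { blocks   = λ _ → glued
    ; nonempty = λ _ → point S ℓ₀ , ∈-glued (point∈ S ℓ₀) Pℓ₀
    ; disjoint = λ { fzero fzero 0≢0 → contradiction refl 0≢0 }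
    ; ρ        = fill S A
    }

  module _ {ν : Word k L} (ν∈line : ν ∈S gluedLine) where

    private
      on-glued : ∀ {i ℓ} → i ∈ blocks S ℓ → P ℓ → ν i ≡ ν (point S ℓ₀)
      on-glued i∈ℓ Pℓ = proj₂ ν∈line fzero _ _ (∈-glued i∈ℓ Pℓ) (∈-glued (point∈ S ℓ₀) Pℓ₀)

      off-glued : ∀ {i ℓ} → i ∈ blocks S ℓ → ¬ P ℓ → ν i ≡ A ℓ
      off-glued i∈ℓ ¬Pℓ = trans (proj₁ ν∈line _ (λ _ → ∉-glued i∈ℓ ¬Pℓ)) (fill-block S A i∈ℓ)

    gluedLine⊆S : ν ∈S S
    gluedLine⊆S = outside , inside
      where
      outside : ∀ i → (∀ ℓ → i ∉ blocks S ℓ) → ν i ≡ ρ S i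
      outside i i∉ = trans (proj₁ ν∈line i (λ _ → ∉-glued-outside i∉)) (fill-outside S A i∉)
      inside : ∀ ℓ i j → i ∈ blocks S ℓ → j ∈ blocks S ℓ → ν i ≡ ν j
      inside ℓ i j i∈ℓ j∈ℓ with P? ℓ
      ... | yes Pℓ = trans (on-glued i∈ℓ Pℓ) (sym (on-glued j∈ℓ Pℓ))
      ... | no ¬Pℓ = trans (off-glued i∈ℓ ¬Pℓ) (sym (off-glued j∈ℓ ¬Pℓ))

    gluedLine-overwrite : Overwrite P A (ν (point S ℓ₀)) (letter S ν)
    gluedLine-overwrite = record
      { inside  = λ ℓ Pℓ → on-glued (point∈ S ℓ) Pℓ
      ; outside = λ ℓ ¬Pℓ → off-glued (point∈ S ℓ) ¬Pℓ
      }

-- Bar charts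

module Bars (w : ℕ) {a : ℕ} where

  Row : Fin (suc a) → ℕ → Set
  Row β = InWindow (toℕ β * w) w

  Bar : (Fin (suc a) → ℕ) → ℕ → Fin (suc a) → Set
  Bar x n β = InWindow (toℕ β * w) (x β) n

  Bounded : (Fin (suc a) → ℕ) → Set
  Bounded x = ∀ β → x β ≤ w

  bar : (Fin (suc a) → ℕ) → ℕ → Fin (suc a)
  bar x n with any? (λ β → inWindow? (toℕ β * w) (x β) n)
  ... | yes (β , _) = β
  ... | no _ = fzero

  row-≤ : ∀ {β α n} → Row β n → Row α n → toℕ β ≤ toℕ α
  row-≤ {β} {α} {n} (βw≤n , _) (_ , n<αw+w) = ≮⇒≥ λ α<β → <⇒≱ n<αw+w (begin
    toℕ α * w + w  ≡⟨ +-comm (toℕ α * w) w ⟩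
    suc (toℕ α) * w ≤⟨ *-monoˡ-≤ w α<β ⟩
    toℕ β * w      ≤⟨ βw≤n ⟩
    n              ∎)
    where open ≤-Reasoning

  row-unique : ∀ {β α n} → Row β n → Row α n → β ≡ α
  row-unique rβ rα = toℕ-injective (≤-antisym (row-≤ rβ rα) (row-≤ rα rβ))

  bar-inside : ∀ {x n α} → Bounded x → Bar x n α → bar x n ≡ α
  bar-inside {x} {n} {α} x≤w n∈α with any? (λ β → inWindow? (toℕ β * w) (x β) n)
  ... | yes (β , n∈β) = row-unique (window-widen (x≤w β) n∈β) (window-widen (x≤w α) n∈α)
  ... | no n∉ = contradiction (α , n∈α) n∉

  bar-none : ∀ {x n} → (∀ β → ¬ Bar x n β) → bar x n ≡ fzero
  bar-none {x} {n} n∉ with any? (λ β → inWindow? (toℕ β * w) (x β) n)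
  ... | yes (β , n∈β) = contradiction n∈β (n∉ β)
  ... | no _ = refl

  bar-past : ∀ {x n α} → Bounded x → Row α n → toℕ α * w + x α ≤ n → bar x n ≡ fzero
  bar-past {x} {n} {α} x≤w n∈row past = bar-none n∉
    where
    n∉ : ∀ β → ¬ Bar x n β
    n∉ β n∈β with row-unique {β} {α} (window-widen (x≤w β) n∈β) n∈row
    ... | refl = <⇒≱ (proj₂ n∈β) past

  bar-first-row : ∀ {x n} → Bounded x → n < w → bar x n ≡ fzero
  bar-first-row {x} {n} x≤w n<w = by-cases (n <? x fzero)
    where
    by-cases : Dec (n < x fzero) → bar x n ≡ fzero
    by-cases (yes n<x₀) = bar-inside x≤w (z≤n , n<x₀)
    by-cases (no n≮x₀) = bar-past {α = fzero} x≤w (z≤n , n<w) (≮⇒≥ n≮x₀)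

  bar-cong : ∀ {x y n} → Bounded x → Bounded y →
    (∀ β → Bar x n β → Bar y n β) → (∀ β → Bar y n β → Bar x n β) → bar x n ≡ bar y n
  bar-cong {x} {y} {n} x≤w y≤w x⇒y y⇒x with any? (λ β → inWindow? (toℕ β * w) (x β) n)
  ... | yes (β , n∈β) = sym (bar-inside y≤w (x⇒y β n∈β))
  ... | no n∉ = sym (bar-none (λ β n∈β → n∉ (β , y⇒x β n∈β)))

CountInvariant : ∀ {C k m L} → (Word k L → Fin C) → Subspace k m L → Set
CountInvariant d S = ∀ ν₁ ν₂ → ν₁ ∈S S → ν₂ ∈S S → (∀ α → count S ν₁ α ≡ count S ν₂ α) → d ν₁ ≡ d ν₂

unitVector : ∀ {L} → Fin L → Fin L → ℕ
unitVector α e = if does (e ≟ᶠ α) then 1 else 0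

unitVector≤1 : ∀ {L} (α e : Fin L) → unitVector α e ≤ 1
unitVector≤1 α e with does (e ≟ᶠ α)
... | true = ≤-refl
... | false = z≤n

module GridColouring {a C k m : ℕ} (w : ℕ) (Lw≤m : suc a * w ≤ m)
  (d : Word k (suc a) → Fin C) (S : Subspace k m (suc a)) (d-invariant : CountInvariant d S) where

  open Bars w

  encode : (Fin (suc a) → ℕ) → Fin m → Fin (suc a)
  encode x ℓ = bar x (toℕ ℓ)

  colour : (Fin (suc a) → Fin w) → Fin C
  colour x = d (fill S (encode (toℕ ∘ x)))

  module Line (δ : ℕ) (0<δ : 0 < δ) (base : Fin (suc a) → ℕ) (base+δ<w : ∀ e → base e + δ < w) where

    Window₀ : Fin m → Set
    Window₀ ℓ = InWindow 0 δ (toℕ ℓ)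

    start : Fin (suc a) → ℕ
    start α = toℕ α * w + base α

    Window : Fin (suc a) → Fin m → Set
    Window α ℓ = InWindow (start α) δ (toℕ ℓ)

    window-in-row : ∀ α → start α + δ ≤ toℕ α * w + w
    window-in-row α = ≤-trans (≤-reflexive (+-assoc (toℕ α * w) (base α) δ)) (+-monoʳ-≤ _ (<⇒≤ (base+δ<w α)))

    window-end : ∀ α → start α + δ ≤ m
    window-end α = ≤-trans (window-in-row α)
      (≤-trans (≤-reflexive (+-comm (toℕ α * w) w)) (≤-trans (*-monoˡ-≤ w (toℕ<n α)) Lw≤m))

    δ<w : δ < w
    δ<w = ≤-<-trans (m≤n+m δ (base fzero)) (base+δ<w fzero)

    δ≤m : δ ≤ m
    δ≤m = m+n≤o⇒n≤o (start fzero) (window-end fzero)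

    base≤w : Bounded base
    base≤w e = <⇒≤ (≤-<-trans (m≤m+n (base e) δ) (base+δ<w e))

    ℓ₀ : Fin m
    ℓ₀ = fromℕ< (<-≤-trans 0<δ δ≤m)

    ℓ₀∈Window₀ : Window₀ ℓ₀
    ℓ₀∈Window₀ = z≤n , subst (_< δ) (sym (toℕ-fromℕ< (<-≤-trans 0<δ δ≤m))) 0<δ

    line : Subspace k 1 (suc a)
    line = gluedLine S (inWindow? 0 δ ∘ toℕ) ℓ₀ ℓ₀∈Window₀ (encode base)

    corner-bound : ∀ α e → base e + δ * unitVector α e < w
    corner-bound α e = ≤-<-trans (+-monoʳ-≤ (base e) (≤-trans (*-monoʳ-≤ δ (unitVector≤1 α e)) (≤-reflexive (*-identityʳ δ))))
      (base+δ<w e)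

    corner : Fin (suc a) → Fin (suc a) → Fin w
    corner α e = fromℕ< (corner-bound α e)

    corner-on : ∀ α → toℕ (corner α α) ≡ base α + δ
    corner-on α = begin
      toℕ (corner α α)                ≡⟨ toℕ-fromℕ< (corner-bound α α) ⟩
      base α + δ * unitVector α α     ≡⟨ cong (λ b → base α + δ * (if b then 1 else 0)) (dec-true (α ≟ᶠ α) refl) ⟩
      base α + δ * 1                  ≡⟨ cong (base α +_) (*-identityʳ δ) ⟩
      base α + δ                      ∎
      where open ≡-Reasoning

    corner-off : ∀ α e → e ≢ α → toℕ (corner α e) ≡ base e
    corner-off α e e≢α = begin
      toℕ (corner α e)                ≡⟨ toℕ-fromℕ< (corner-bound α e) ⟩
      base e + δ * unitVector α e     ≡⟨ cong (λ b → base e + δ * (if b then 1 else 0)) (dec-false (e ≟ᶠ α) e≢α) ⟩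
      base e + δ * 0                  ≡⟨ cong (base e +_) (*-zeroʳ δ) ⟩
      base e + 0                      ≡⟨ +-identityʳ (base e) ⟩
      base e                          ∎
      where open ≡-Reasoning

    corner≤w : ∀ α → Bounded (toℕ ∘ corner α)
    corner≤w α e = <⇒≤ (toℕ<n (corner α e))

    encode-base-Window₀ : ∀ ℓ → Window₀ ℓ → encode base ℓ ≡ fzero
    encode-base-Window₀ ℓ (_ , ℓ<δ) = bar-first-row base≤w (<-trans ℓ<δ δ<w)

    encode-base-Window : ∀ α ℓ → Window α ℓ → encode base ℓ ≡ fzero
    encode-base-Window α ℓ (start≤ℓ , ℓ<end) =
      bar-past base≤w (≤-trans (m≤m+n _ _) start≤ℓ , <-≤-trans ℓ<end (window-in-row α)) start≤ℓ

    encode-corner : ∀ α → Overwrite (Window α) (encode base) α (encode (toℕ ∘ corner α))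
    encode-corner α = record { inside = inside ; outside = outside }
      where
      inside : ∀ ℓ → Window α ℓ → encode (toℕ ∘ corner α) ℓ ≡ α
      inside ℓ (start≤ℓ , ℓ<end) = bar-inside (corner≤w α)
        ( ≤-trans (m≤m+n _ _) start≤ℓ
        , subst (toℕ ℓ <_) (trans (+-assoc (toℕ α * w) (base α) δ) (cong (toℕ α * w +_) (sym (corner-on α)))) ℓ<end)
      outside : ∀ ℓ → ¬ Window α ℓ → encode (toℕ ∘ corner α) ℓ ≡ encode base ℓ
      outside ℓ ℓ∉ = bar-cong (corner≤w α) base≤w to from
        where
        to : ∀ β → Bar (toℕ ∘ corner α) (toℕ ℓ) β → Bar base (toℕ ℓ) β
        to β = by-cases (β ≟ᶠ α)
          where
          by-cases : Dec (β ≡ α) → Bar (toℕ ∘ corner α) (toℕ ℓ) β → Bar base (toℕ ℓ) β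
          by-cases (yes refl) ℓ∈ = window-cut (subst (λ c → InWindow (toℕ β * w) c (toℕ ℓ)) (corner-on β) ℓ∈) ℓ∉
          by-cases (no β≢α) = subst (λ c → InWindow (toℕ β * w) c (toℕ ℓ)) (corner-off α β β≢α)
        from : ∀ β → Bar base (toℕ ℓ) β → Bar (toℕ ∘ corner α) (toℕ ℓ) β
        from β = by-cases (β ≟ᶠ α)
          where
          by-cases : Dec (β ≡ α) → Bar base (toℕ ℓ) β → Bar (toℕ ∘ corner α) (toℕ ℓ) β
          by-cases (yes refl) ℓ∈ =
            subst (λ c → InWindow (toℕ β * w) c (toℕ ℓ)) (sym (corner-on β)) (window-widen (m≤m+n _ δ) ℓ∈)
          by-cases (no β≢α) = subst (λ c → InWindow (toℕ β * w) c (toℕ ℓ)) (sym (corner-off α β β≢α))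

    line-colour : ∀ {ν} → ν ∈S line → d ν ≡ colour (corner (ν (point S ℓ₀)))
    line-colour {ν} ν∈line = d-invariant ν (fill S (encode (toℕ ∘ corner α)))
      (gluedLine⊆S S _ ℓ₀ ℓ₀∈Window₀ (encode base) ν∈line) (fill-∈S S _) same-counts
      where
      α : Fin (suc a)
      α = ν (point S ℓ₀)
      filled-corner : Overwrite (Window α) (encode base) α (letter S (fill S (encode (toℕ ∘ corner α))))
      filled-corner = record
        { inside  = λ ℓ ℓ∈ → trans (letter-fill S _ ℓ) (Overwrite.inside (encode-corner α) ℓ ℓ∈)
        ; outside = λ ℓ ℓ∉ → trans (letter-fill S _ ℓ) (Overwrite.outside (encode-corner α) ℓ ℓ∉)
        }
      same-size : countBy (inWindow? 0 δ ∘ toℕ) (allFin m) ≡ countBy (inWindow? (start α) δ ∘ toℕ) (allFin m)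
      same-size = trans (countBy-window 0 δ δ≤m) (sym (countBy-window (start α) δ (window-end α)))
      same-counts : ∀ γ → count S ν γ ≡ count S (fill S (encode (toℕ ∘ corner α))) γ
      same-counts γ = begin
        count S ν γ
          ≡⟨ count-letter S (gluedLine⊆S S _ ℓ₀ ℓ₀∈Window₀ (encode base) ν∈line) γ ⟩
        countBy (λ ℓ → letter S ν ℓ ≟ᶠ γ) (allFin m)
          ≡⟨ countBy-overwrites _≟ᶠ_ (inWindow? 0 δ ∘ toℕ) (inWindow? (start α) δ ∘ toℕ) (allFin m) same-size
               encode-base-Window₀ (encode-base-Window α)
               (gluedLine-overwrite S _ ℓ₀ ℓ₀∈Window₀ (encode base) ν∈line) filled-corner γ ⟩
        countBy (λ ℓ → letter S (fill S (encode (toℕ ∘ corner α))) ℓ ≟ᶠ γ) (allFin m)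
          ≡⟨ count-letter S (fill-∈S S _) γ ⟨
        count S (fill S (encode (toℕ ∘ corner α))) γ ∎
        where open ≡-Reasoning

    corner∈cube : ∀ α → ∃ λ (i : Fin (suc a) → ℕ) → (∀ e → i e ≤ 1) × (∀ e → toℕ (corner α e) ≡ base e + δ * i e)
    corner∈cube α = unitVector α , unitVector≤1 α , λ e → toℕ-fromℕ< (corner-bound α e)

    line-monochromatic : (∀ α β → colour (corner α) ≡ colour (corner β)) →
      ∀ ν₁ ν₂ → ν₁ ∈S line → ν₂ ∈S line → d ν₁ ≡ d ν₂
    line-monochromatic corners-same ν₁ ν₂ ν₁∈ ν₂∈ =
      trans (line-colour ν₁∈) (trans (corners-same _ _) (sym (line-colour ν₂∈)))

countInvariant⇒HJ : ∀ {a C m} w k → WProp C (suc a) 1 w → suc a * w ≤ m →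
  (∀ (d : Word k (suc a) → Fin C) → Σ (Subspace k m (suc a)) (CountInvariant d)) →
  HJProp C 1 (suc a) k
countInvariant⇒HJ w k gallaiWitt Lw≤m invariant d =
  let S , d-invariant = invariant d
      open GridColouring w Lw≤m d S d-invariant
      δ , 0<δ , base , base+δ<w , cube-monochromatic = gallaiWitt colour
      open Line δ 0<δ base (λ e → subst (λ t → base e + t < w) (*-identityʳ δ) (base+δ<w e))
  in line , line-monochromatic (λ α β → cube-monochromatic _ _ (corner∈cube α) (corner∈cube β))

mainTheorem1 : (a c : ℕ) →
    (w : ℕ) → IsW (suc c) (suc a) 1 w →
    (k : ℕ) → IsF8 (suc c) (suc a) ((suc a * suc a) * w) k →
    (h : ℕ) → IsHJ (suc c) 1 (suc a) h →
    h ≤ k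
mainTheorem1 a c w (gallaiWitt , _) k ((_ , invariant) , _) h (_ , hj-least) =
  hj-least k (countInvariant⇒HJ w k gallaiWitt (*-monoˡ-≤ w (m≤m*n (suc a) (suc a))) invariant)
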